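{- For all integers $\ell\ge 1$ and $0\le r<2^\ell$, the sequence $(S(n))_{n\ge 0}$ satisfies $S(0)=1$, $S(1)=2$ and $$S(2^{\ell}+r)=\begin{cases} S(2^{\ell-1}+r)+S(r), & \text{if } 0\le r<2^{\ell-1};\\ S(2^{\ell+1}-r-1), & \text{if } 2^{\ell-1}\le r<2^{\ell}.\end{cases}$$
   Context: For finite words $u,v$ over $\{0,1\}$, the binomial coefficient $\binom{u}{v}$ is the number of occurrences of $v$ as a (scattered) subword of $u$, i.e., the number of index sequences $i_1<\dots<i_{|v|}$ with $u_{i_1}\cdots u_{i_{|v|}}=v$. For $n\ge 1$, $\mathrm{rep}_2(n)$ is the usual base-$2$ expansion of $n$ written with most significant digit first (so it starts with $1$), and $\mathrm{rep}_2(0)=\varepsilon$ is the empty word. Let $L_2=\{\varepsilon\}\cup 1\{0,1\}^*$. For $n\ge 0$, $S(n)=\#\{v\in L_2 : \binom{\mathrm{rep}_2(n)}{v}>0\}$. -}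

module Defs where

open import Data.Bool using (Bool; true; false; if_then_else_; _∧_)
open import Data.Bool.Properties using () renaming (_≟_ to _≟ᵇ_)
open import Data.Nat using (ℕ; zero; suc; _+_; _<?_; _≤?_; _%_; _/_; _≡ᵇ_)
open import Data.List using (List; []; _∷_; reverse; length; filter; map; concat; _++_)
open import Relation.Nullary using (Dec; yes; no; does)
open import Relation.Nullary.Decidable using (_×-dec_)
open import Data.Product using (_×_)
open import Relation.Binary.PropositionalEquality using (_≡_)

-- Binary words: false = letter 0, true = letter 1.
Word : Set
Word = List Bool

binom : Word → Word → ℕ
binom u [] = 1
binom [] (_ ∷ _) = 0
binom (a ∷ u) (b ∷ v) =
  binom u (b ∷ v) + (if does (a ≟ᵇ b) then binom u v else 0)

-- Least-significant-digit-first base-2 digits, with fuel.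
lsbDigits : ℕ → ℕ → Word
lsbDigits zero _ = []
lsbDigits (suc f) zero = []
lsbDigits (suc f) n@(suc _) = (n % 2 ≡ᵇ 1) ∷ lsbDigits f (n / 2)

-- rep_2(n): most significant digit first; rep_2(0) = ε.
rep2 : ℕ → Word
rep2 n = reverse (lsbDigits n n)

data InL2 : Word → Set where
  L2-ε : InL2 []
  L2-1 : (w : Word) → InL2 (true ∷ w)

InL2? : (w : Word) → Dec (InL2 w)
InL2? [] = yes L2-ε
InL2? (true ∷ w) = yes (L2-1 w)
InL2? (false ∷ w) = no (λ ())

wordsOfLength : ℕ → List Word
wordsOfLength zero = [] ∷ []
wordsOfLength (suc k) = map (false ∷_) (wordsOfLength k) ++ map (true ∷_) (wordsOfLength k)

wordsUpTo : ℕ → List Word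
wordsUpTo zero = wordsOfLength zero
wordsUpTo (suc k) = wordsUpTo k ++ wordsOfLength (suc k)

-- S(n) = #{ v ∈ L_2 : binom(rep_2 n, v) > 0 }.
-- Any v with binom(u,v) > 0 has |v| ≤ |u|, so it suffices to enumerate
-- all words of length ≤ |rep_2 n| (each exactly once).
S : ℕ → ℕ
S n = length (filter (λ v → InL2? v ×-dec (0 <? binom u v)) (wordsUpTo (length u)))
  where u = rep2 n

-- Write rep₂(n) = 1u. An L₂-word is ε or 1w, and 1w occurs in 1u exactly when w occurs in u,
-- so S(n) = 1 + sub(u), where sub counts distinct subwords. Besides ε, the subwords of 0x are the
-- words 0w with w a subword of x and the subwords of x beginning with 1, so sub(0x) = sub(x) + S(x)
-- (leading zeros add no L₂-subwords), which is the first case: S(1 0x) = S(1x) + S(x). Exchanging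
-- the letters preserves sub, so S(1 1x) = S(1 0x̄), and 1 0x̄ is the expansion of 2^{ℓ+1} - r - 1.

module Submission where

open import Data.Bool using (Bool; true; false; not; _∨_; if_then_else_)
open import Data.Bool.Properties using () renaming (_≟_ to _≟ᵇ_)
open import Data.List using (List; []; _∷_; _++_; _∷ʳ_; map; reverse; length; filter)
open import Data.List.Properties using (length-map; length-++; reverse-++; reverse-involutive)
open import Data.List.Reverse using (Reverse; []; _∶_∶ʳ_; reverseView)
open import Data.Nat
  using ( ℕ; zero; suc; _+_; _*_; _∸_; _^_; _≤_; _<_; _≤′_; ≤′-refl; ≤′-step; z≤n; s≤s
        ; _<?_; _%_; _/_; _≡ᵇ_; >-nonZero)
open import Data.Nat.DivMod using ([m+kn]%n≡m%n; m*n/n≡m; +-distrib-/-∣ʳ)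
open import Data.Nat.Divisibility using (divides)
open import Data.Nat.Properties
open import Data.Nat.Solver using (module +-*-Solver)
open import Data.Product using (∃-syntax; _×_; _,_)
open import Function using (_∘_)
open import Relation.Binary.PropositionalEquality
  using (_≡_; _≢_; refl; sym; trans; cong; cong₂; subst; module ≡-Reasoning)
open import Relation.Nullary using (does; yes; no; contradiction)
open import Relation.Nullary.Decidable using (_×-dec_)
open import Relation.Unary using (Decidable)

open import Defs

open +-*-Solver
open ≡-Reasoning

private
  variable
    A B : Set

-- Counting

fromBit : Bool → ℕ
fromBit false = 0
fromBit true  = 1

count : (A → Bool) → List A → ℕ
count p []       = 0
count p (x ∷ xs) = fromBit (p x) + count p xs

length-filter : ∀ {P : A → Set} (P? : Decidable P) xs →
                length (filter P? xs) ≡ count (λ x → does (P? x)) xs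
length-filter P? []       = refl
length-filter P? (x ∷ xs) with does (P? x)
... | true  = cong suc (length-filter P? xs)
... | false = length-filter P? xs

count-++ : ∀ (p : A → Bool) xs ys → count p (xs ++ ys) ≡ count p xs + count p ys
count-++ p []       ys = refl
count-++ p (x ∷ xs) ys =
  trans (cong (fromBit (p x) +_) (count-++ p xs ys)) (sym (+-assoc (fromBit (p x)) _ _))

count-map : ∀ (p : B → Bool) (f : A → B) xs → count p (map f xs) ≡ count (p ∘ f) xs
count-map p f []       = refl
count-map p f (x ∷ xs) = cong (fromBit (p (f x)) +_) (count-map p f xs)

count-cong : ∀ {p q : A → Bool} → (∀ x → p x ≡ q x) → ∀ xs → count p xs ≡ count q xs
count-cong e []       = refl
count-cong e (x ∷ xs) = cong₂ _+_ (cong fromBit (e x)) (count-cong e xs)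

countWords : ℕ → (Word → Bool) → ℕ
countWords k p = count p (wordsOfLength k)

countWords-suc : ∀ k p →
  countWords (suc k) p ≡ countWords k (p ∘ (false ∷_)) + countWords k (p ∘ (true ∷_))
countWords-suc k p = trans (count-++ p (map (false ∷_) W) (map (true ∷_) W))
                           (cong₂ _+_ (count-map p (false ∷_) W) (count-map p (true ∷_) W))
  where W = wordsOfLength k

countWords-cong : ∀ k {p q} → (∀ v → p v ≡ q v) → countWords k p ≡ countWords k q
countWords-cong k e = count-cong e (wordsOfLength k)

countWords-none : ∀ k p → (∀ v → length v ≡ k → p v ≡ false) → countWords k p ≡ 0
countWords-none zero    p none = cong (λ b → fromBit b + 0) (none [] refl)
countWords-none (suc k) p none = trans (countWords-suc k p)
  (cong₂ _+_ (countWords-none k _ (λ v e → none (false ∷ v) (cong suc e)))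
             (countWords-none k _ (λ v e → none (true ∷ v) (cong suc e))))

countWords-complement : ∀ k p → countWords k (p ∘ map not) ≡ countWords k p
countWords-complement zero    p = refl
countWords-complement (suc k) p = begin
  countWords (suc k) (p ∘ map not)
    ≡⟨ countWords-suc k (p ∘ map not) ⟩
  countWords k (p ∘ (true ∷_) ∘ map not) + countWords k (p ∘ (false ∷_) ∘ map not)
    ≡⟨ cong₂ _+_ (countWords-complement k (p ∘ (true ∷_)))
                 (countWords-complement k (p ∘ (false ∷_))) ⟩
  countWords k (p ∘ (true ∷_)) + countWords k (p ∘ (false ∷_))
    ≡⟨ +-comm (countWords k (p ∘ (true ∷_))) _ ⟩
  countWords k (p ∘ (false ∷_)) + countWords k (p ∘ (true ∷_))
    ≡⟨ sym (countWords-suc k p) ⟩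
  countWords (suc k) p ∎

-- Occurrence of subwords

positive : ℕ → Bool
positive n = does (0 <? n)

positive-+ : ∀ m n → positive (m + n) ≡ positive m ∨ positive n
positive-+ zero    n = refl
positive-+ (suc m) n = refl

hasSubword : Word → Word → Bool
hasSubword u v = positive (binom u v)

hasSubword-∷ : ∀ a u w → hasSubword u w ≡ true → hasSubword (a ∷ u) w ≡ true
hasSubword-∷ a u []      _ = refl
hasSubword-∷ a u (b ∷ w) h =
  trans (positive-+ (binom u (b ∷ w)) headMatches) (cong (_∨ positive headMatches) h)
  where headMatches = if does (a ≟ᵇ b) then binom u w else 0

hasSubword-dropHead : ∀ u a w → hasSubword u (a ∷ w) ≡ true → hasSubword u w ≡ true
hasSubword-dropHead (c ∷ u) a w h with hasSubword u (a ∷ w) in e | does (c ≟ᵇ a)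
... | true  | _     = hasSubword-∷ c u w (hasSubword-dropHead u a w e)
... | false | true  = hasSubword-∷ c u w
  (trans (sym (trans (positive-+ (binom u (a ∷ w)) (binom u w)) (cong (_∨ hasSubword u w) e))) h)
... | false | false =
  contradiction (trans (sym (trans (positive-+ (binom u (a ∷ w)) 0) (cong (_∨ false) e))) h) λ ()

hasSubword-∷-∷ : ∀ a y w → hasSubword (a ∷ y) (a ∷ w) ≡ hasSubword y w
hasSubword-∷-∷ a y w = trans (cong positive (cong (binom y (a ∷ w) +_) (if-refl a)))
  (trans (positive-+ (binom y (a ∷ w)) (binom y w)) (absorb (hasSubword-dropHead y a w)))
  where
  if-refl : ∀ a → (if does (a ≟ᵇ a) then binom y w else 0) ≡ binom y w
  if-refl false = refl
  if-refl true  = refl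
  absorb : ∀ {x z} → (x ≡ true → z ≡ true) → x ∨ z ≡ z
  absorb {true}  f = sym (f refl)
  absorb {false} f = refl

hasSubword-mismatch : ∀ {a b} → a ≢ b → ∀ x w →
                      hasSubword (a ∷ x) (b ∷ w) ≡ hasSubword x (b ∷ w)
hasSubword-mismatch {a} {b} a≢b x w with a ≟ᵇ b
... | yes a≡b = contradiction a≡b a≢b
... | no  _   = cong positive (+-identityʳ (binom x (b ∷ w)))

binom-complement : ∀ u v → binom (map not u) (map not v) ≡ binom u v
binom-complement u       []      = refl
binom-complement []      (b ∷ v) = refl
binom-complement (a ∷ u) (b ∷ v) = cong₂ _+_ (binom-complement u (b ∷ v)) (matching a b)
  where
  matching : ∀ a b → (if does (not a ≟ᵇ not b) then binom (map not u) (map not v) else 0)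
                   ≡ (if does (a ≟ᵇ b) then binom u v else 0)
  matching true  true  = binom-complement u v
  matching false false = binom-complement u v
  matching true  false = refl
  matching false true  = refl

binom-long : ∀ u v → length u < length v → binom u v ≡ 0
binom-long []      (b ∷ v) _         = refl
binom-long (a ∷ u) (b ∷ v) (s≤s u<v) =
  cong₂ _+_ (binom-long u (b ∷ v) (m<n⇒m<1+n u<v)) (matching (does (a ≟ᵇ b)))
  where
  matching : ∀ d → (if d then binom u v else 0) ≡ 0
  matching true  = binom-long u v u<v
  matching false = refl

-- Subwords of a fixed length

isL2Subword : Word → Word → Bool
isL2Subword u v = does (InL2? v ×-dec (0 <? binom u v))

#Subwords : ℕ → Word → ℕ
#Subwords k u = countWords k (hasSubword u)

#L2Subwords : ℕ → Word → ℕ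
#L2Subwords k u = countWords k (isL2Subword u)

#L2Subwords-suc : ∀ k u → #L2Subwords (suc k) u ≡ countWords k (hasSubword u ∘ (true ∷_))
#L2Subwords-suc k u =
  trans (countWords-suc k (isL2Subword u))
        (cong (_+ countWords k (hasSubword u ∘ (true ∷_))) (countWords-none k _ (λ _ _ → refl)))

#L2Subwords-true∷ : ∀ k y → #L2Subwords (suc k) (true ∷ y) ≡ #Subwords k y
#L2Subwords-true∷ k y =
  trans (#L2Subwords-suc k (true ∷ y)) (countWords-cong k (hasSubword-∷-∷ true y))

#L2Subwords-false∷ : ∀ k x → #L2Subwords k (false ∷ x) ≡ #L2Subwords k x
#L2Subwords-false∷ zero    x = refl
#L2Subwords-false∷ (suc k) x = trans (#L2Subwords-suc k (false ∷ x))
  (trans (countWords-cong k (hasSubword-mismatch {false} {true} (λ ()) x)) (sym (#L2Subwords-suc k x)))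

#Subwords-false∷ : ∀ k x → #Subwords (suc k) (false ∷ x) ≡ #Subwords k x + #L2Subwords (suc k) x
#Subwords-false∷ k x = trans (countWords-suc k (hasSubword (false ∷ x)))
  (cong₂ _+_ (countWords-cong k (hasSubword-∷-∷ false x))
             (trans (countWords-cong k (hasSubword-mismatch {false} {true} (λ ()) x))
                    (sym (#L2Subwords-suc k x))))

#Subwords-complement : ∀ k u → #Subwords k (map not u) ≡ #Subwords k u
#Subwords-complement k u = trans (sym (countWords-complement k (hasSubword (map not u))))
  (countWords-cong k (λ v → cong positive (binom-complement u v)))

#L2Subwords-long : ∀ k u → length u < k → #L2Subwords k u ≡ 0
#L2Subwords-long k u u<k = countWords-none k (isL2Subword u) none
  where
  none : ∀ v → length v ≡ k → isL2Subword u v ≡ false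
  none []          refl = contradiction u<k λ ()
  none (false ∷ w) _    = refl
  none (true ∷ w)  refl = cong positive (binom-long u (true ∷ w) u<k)

-- Subwords of bounded length

sumUpTo : (ℕ → ℕ) → ℕ → ℕ
sumUpTo f zero    = f 0
sumUpTo f (suc m) = sumUpTo f m + f (suc m)

sumUpTo-cong : ∀ {f g} m → (∀ k → f k ≡ g k) → sumUpTo f m ≡ sumUpTo g m
sumUpTo-cong zero    e = e 0
sumUpTo-cong (suc m) e = cong₂ _+_ (sumUpTo-cong m e) (e (suc m))

sumUpTo-suc : ∀ f m → sumUpTo f (suc m) ≡ f 0 + sumUpTo (f ∘ suc) m
sumUpTo-suc f zero    = refl
sumUpTo-suc f (suc m) =
  trans (cong (_+ f (suc (suc m))) (sumUpTo-suc f m)) (+-assoc (f 0) _ _)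

sumUpTo-+ : ∀ f g m → sumUpTo (λ k → f k + g k) m ≡ sumUpTo f m + sumUpTo g m
sumUpTo-+ f g zero    = refl
sumUpTo-+ f g (suc m) =
  trans (cong (_+ (f (suc m) + g (suc m))) (sumUpTo-+ f g m))
        (interchange (sumUpTo f m) (sumUpTo g m) (f (suc m)) (g (suc m)))
  where
  interchange : ∀ a b c d → (a + b) + (c + d) ≡ (a + c) + (b + d)
  interchange = solve 4 (λ a b c d → (a :+ b) :+ (c :+ d) := (a :+ c) :+ (b :+ d)) refl

#Subwords≤ : ℕ → Word → ℕ
#Subwords≤ m u = sumUpTo (λ k → #Subwords k u) m

#L2Subwords≤ : ℕ → Word → ℕ
#L2Subwords≤ m u = sumUpTo (λ k → #L2Subwords k u) m

S≡#L2Subwords≤ : ∀ n → S n ≡ #L2Subwords≤ (length (rep2 n)) (rep2 n)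
S≡#L2Subwords≤ n = trans (length-filter (λ v → InL2? v ×-dec (0 <? binom u v)) (wordsUpTo (length u)))
                          (count-wordsUpTo (length u))
  where
  u = rep2 n
  count-wordsUpTo : ∀ m → count (isL2Subword u) (wordsUpTo m) ≡ #L2Subwords≤ m u
  count-wordsUpTo zero    = refl
  count-wordsUpTo (suc m) = trans (count-++ (isL2Subword u) (wordsUpTo m) _)
                                  (cong (_+ #L2Subwords (suc m) u) (count-wordsUpTo m))

#L2Subwords≤-true∷ : ∀ m y → #L2Subwords≤ (suc m) (true ∷ y) ≡ suc (#Subwords≤ m y)
#L2Subwords≤-true∷ m y =
  trans (sumUpTo-suc _ m) (cong suc (sumUpTo-cong m (λ k → #L2Subwords-true∷ k y)))

#L2Subwords≤-false∷ : ∀ m x → #L2Subwords≤ m (false ∷ x) ≡ #L2Subwords≤ m x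
#L2Subwords≤-false∷ m x = sumUpTo-cong m (λ k → #L2Subwords-false∷ k x)

#Subwords≤-false∷ : ∀ m x →
  #Subwords≤ (suc m) (false ∷ x) ≡ #Subwords≤ m x + #L2Subwords≤ (suc m) x
#Subwords≤-false∷ m x = begin
  #Subwords≤ (suc m) (false ∷ x)
    ≡⟨ sumUpTo-suc _ m ⟩
  suc (sumUpTo (λ k → #Subwords (suc k) (false ∷ x)) m)
    ≡⟨ cong suc (sumUpTo-cong m (λ k → #Subwords-false∷ k x)) ⟩
  suc (sumUpTo (λ k → #Subwords k x + #L2Subwords (suc k) x) m)
    ≡⟨ cong suc (sumUpTo-+ _ _ m) ⟩
  suc (#Subwords≤ m x + sumUpTo (λ k → #L2Subwords (suc k) x) m)
    ≡⟨ sym (+-suc (#Subwords≤ m x) _) ⟩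
  #Subwords≤ m x + suc (sumUpTo (λ k → #L2Subwords (suc k) x) m)
    ≡⟨ cong (#Subwords≤ m x +_) (sym (sumUpTo-suc _ m)) ⟩
  #Subwords≤ m x + #L2Subwords≤ (suc m) x ∎

#Subwords≤-complement : ∀ m u → #Subwords≤ m (map not u) ≡ #Subwords≤ m u
#Subwords≤-complement m u = sumUpTo-cong m (λ k → #Subwords-complement k u)

#L2Subwords≤-stable : ∀ u {m} → length u ≤ m → #L2Subwords≤ m u ≡ #L2Subwords≤ (length u) u
#L2Subwords≤-stable u h = go (≤⇒≤′ h)
  where
  go : ∀ {m} → length u ≤′ m → #L2Subwords≤ m u ≡ #L2Subwords≤ (length u) u
  go ≤′-refl              = refl
  go {suc m} (≤′-step h′) =
    trans (cong (#L2Subwords≤ m u +_) (#L2Subwords-long _ u (s≤s (≤′⇒≤ h′))))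
          (trans (+-identityʳ _) (go h′))

-- Binary expansions

value : Word → ℕ
value []      = 0
value (b ∷ u) = fromBit b * 2 ^ length u + value u

value-true∷ : ∀ u → value (true ∷ u) ≡ 2 ^ length u + value u
value-true∷ u = cong (_+ value u) (*-identityˡ (2 ^ length u))

value-∷ʳ : ∀ u b → value (u ∷ʳ b) ≡ fromBit b + value u * 2
value-∷ʳ []      b = cong (_+ 0) (*-identityʳ (fromBit b))
value-∷ʳ (a ∷ u) b = begin
  fromBit a * 2 ^ length (u ∷ʳ b) + value (u ∷ʳ b)
    ≡⟨ cong₂ (λ n v → fromBit a * 2 ^ n + v)
             (trans (length-++ u) (+-comm (length u) 1)) (value-∷ʳ u b) ⟩
  fromBit a * (2 * 2 ^ length u) + (fromBit b + value u * 2)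
    ≡⟨ shift (fromBit a) (fromBit b) (2 ^ length u) (value u) ⟩
  fromBit b + (fromBit a * 2 ^ length u + value u) * 2 ∎
  where
  shift : ∀ a b p v → a * (2 * p) + (b + v * 2) ≡ b + (a * p + v) * 2
  shift = solve 4 (λ a b p v → a :* (con 2 :* p) :+ (b :+ v :* con 2) := b :+ (a :* p :+ v) :* con 2) refl

value-complement : ∀ u → suc (value u + value (map not u)) ≡ 2 ^ length u
value-complement []      = refl
value-complement (a ∷ u) = begin
  suc (value (a ∷ u) + value (map not (a ∷ u)))
    ≡⟨ cong (λ n → suc (value (a ∷ u) + (fromBit (not a) * 2 ^ n + v̄))) (length-map not u) ⟩
  suc ((fromBit a * p + v) + (fromBit (not a) * p + v̄))
    ≡⟨ digits a ⟩
  p + suc (v + v̄)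
    ≡⟨ cong (p +_) (value-complement u) ⟩
  p + p
    ≡⟨ cong (p +_) (sym (+-identityʳ p)) ⟩
  2 * p ∎
  where
  p = 2 ^ length u
  v = value u
  v̄ = value (map not u)
  digits : ∀ a → suc ((fromBit a * p + v) + (fromBit (not a) * p + v̄)) ≡ p + suc (v + v̄)
  digits true  = solve 3 (λ p v v̄ → con 1 :+ ((con 1 :* p :+ v) :+ (con 0 :* p :+ v̄))
                                   := p :+ (con 1 :+ (v :+ v̄))) refl p v v̄
  digits false = solve 3 (λ p v v̄ → con 1 :+ ((con 0 :* p :+ v) :+ (con 1 :* p :+ v̄))
                                   := p :+ (con 1 :+ (v :+ v̄))) refl p v v̄

m<2n⇒m∸n<n : ∀ {m n} → n ≤ m → m < 2 * n → m ∸ n < n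
m<2n⇒m∸n<n {m} {n} n≤m m<2n =
  subst (m ∸ n <_) (m+n∸m≡n n n) (∸-monoˡ-< (subst (m <_) (cong (n +_) (+-identityʳ n)) m<2n) n≤m)

bits : ∀ m r → r < 2 ^ m → ∃[ u ] length u ≡ m × value u ≡ r
bits zero    zero    _         = [] , refl , refl
bits zero    (suc r) (s≤s ())
bits (suc m) r r<  with r <? 2 ^ m
... | yes r<′ with bits m r r<′
...   | u , refl , refl = false ∷ u , refl , refl
bits (suc m) r r<  | no r≮ with bits m (r ∸ 2 ^ m) (m<2n⇒m∸n<n (≮⇒≥ r≮) r<)
...   | u , refl , v≡ = true ∷ u , refl ,
  trans (value-true∷ u) (trans (cong (2 ^ length u +_) v≡) (m+[n∸m]≡n (≮⇒≥ r≮)))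

lsbDigits-zero : ∀ f → lsbDigits f 0 ≡ []
lsbDigits-zero zero    = refl
lsbDigits-zero (suc f) = refl

lsbDigits-suc : ∀ f n → 0 < n → lsbDigits (suc f) n ≡ (n % 2 ≡ᵇ 1) ∷ lsbDigits f (n / 2)
lsbDigits-suc f (suc n) _ = refl

lastDigit : ∀ b q → ((fromBit b + q * 2) % 2 ≡ᵇ 1) ≡ b
lastDigit false q = cong (_≡ᵇ 1) ([m+kn]%n≡m%n 0 q 2)
lastDigit true  q = cong (_≡ᵇ 1) ([m+kn]%n≡m%n 1 q 2)

dropLastDigit : ∀ b q → (fromBit b + q * 2) / 2 ≡ q
dropLastDigit false q = m*n/n≡m q 2
dropLastDigit true  q = trans (+-distrib-/-∣ʳ 1 {d = 2} (divides q refl)) (m*n/n≡m q 2)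

lsbDigits-value : ∀ u f → value (true ∷ u) ≤ f →
                  lsbDigits f (value (true ∷ u)) ≡ reverse (true ∷ u)
lsbDigits-value u = go (reverseView u)
  where
  go : ∀ {u} → Reverse u → ∀ f → value (true ∷ u) ≤ f →
       lsbDigits f (value (true ∷ u)) ≡ reverse (true ∷ u)
  go [] (suc f) _ = cong (true ∷_) (lsbDigits-zero f)
  go (u ∶ rs ∶ʳ b) f h = begin
    lsbDigits f (value (true ∷ u ∷ʳ b))
      ≡⟨ cong (lsbDigits f) (value-∷ʳ (true ∷ u) b) ⟩
    lsbDigits f n
      ≡⟨ digits f (subst (_≤ f) (value-∷ʳ (true ∷ u) b) h) ⟩
    b ∷ reverse (true ∷ u)
      ≡⟨ sym (reverse-++ (true ∷ u) (b ∷ [])) ⟩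
    reverse (true ∷ u ∷ʳ b) ∎
    where
    v = value (true ∷ u)
    n = fromBit b + v * 2
    0<v : 0 < v
    0<v = subst (0 <_) (sym (value-true∷ u)) (≤-trans (m^n>0 2 (length u)) (m≤m+n _ (value u)))
    v<n : v < n
    v<n = <-≤-trans (m<m*n v 2 {{>-nonZero 0<v}} (s≤s (s≤s z≤n))) (m≤n+m (v * 2) (fromBit b))
    digits : ∀ f → n ≤ f → lsbDigits f n ≡ b ∷ reverse (true ∷ u)
    digits zero    n≤0 = contradiction (≤-trans v<n n≤0) λ ()
    digits (suc f) n≤ = trans (lsbDigits-suc f n (<-≤-trans 0<v (<⇒≤ v<n)))
      (cong₂ _∷_ (lastDigit b v)
                 (trans (cong (lsbDigits f) (dropLastDigit b v)) (go rs f (≤-pred (≤-trans v<n n≤)))))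

rep2-value-true∷ : ∀ u → rep2 (value (true ∷ u)) ≡ true ∷ u
rep2-value-true∷ u = trans (cong reverse (lsbDigits-value u _ ≤-refl)) (reverse-involutive (true ∷ u))

S-value : ∀ u m → length u ≤ m → #L2Subwords≤ m u ≡ S (value u)
S-value []          m _ = #L2Subwords≤-stable [] {m} z≤n
S-value (false ∷ u) m h = trans (#L2Subwords≤-false∷ m u) (S-value u m (≤-trans (n≤1+n _) h))
S-value (true ∷ u)  m h = begin
  #L2Subwords≤ m (true ∷ u)
    ≡⟨ #L2Subwords≤-stable (true ∷ u) h ⟩
  #L2Subwords≤ (length (true ∷ u)) (true ∷ u)
    ≡⟨ cong (λ w → #L2Subwords≤ (length w) w) (sym (rep2-value-true∷ u)) ⟩
  #L2Subwords≤ (length (rep2 (value (true ∷ u)))) (rep2 (value (true ∷ u)))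
    ≡⟨ sym (S≡#L2Subwords≤ (value (true ∷ u))) ⟩
  S (value (true ∷ u)) ∎

-- The recurrences

S-lowerHalf : ∀ x → S (2 ^ suc (length x) + value x) ≡ S (2 ^ length x + value x) + S (value x)
S-lowerHalf x = begin
  S (2 ^ suc n + value x)
    ≡⟨ cong S (sym (value-true∷ (false ∷ x))) ⟩
  S (value (true ∷ false ∷ x))
    ≡⟨ sym (S-value (true ∷ false ∷ x) _ ≤-refl) ⟩
  #L2Subwords≤ (suc (suc n)) (true ∷ false ∷ x)
    ≡⟨ #L2Subwords≤-true∷ (suc n) (false ∷ x) ⟩
  suc (#Subwords≤ (suc n) (false ∷ x))
    ≡⟨ cong suc (#Subwords≤-false∷ n x) ⟩
  suc (#Subwords≤ n x + #L2Subwords≤ (suc n) x)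
    ≡⟨ cong (_+ #L2Subwords≤ (suc n) x) (sym (#L2Subwords≤-true∷ n x)) ⟩
  #L2Subwords≤ (suc n) (true ∷ x) + #L2Subwords≤ (suc n) x
    ≡⟨ cong₂ _+_ (S-value (true ∷ x) _ ≤-refl) (S-value x _ (n≤1+n n)) ⟩
  S (value (true ∷ x)) + S (value x)
    ≡⟨ cong (λ t → S t + S (value x)) (value-true∷ x) ⟩
  S (2 ^ n + value x) + S (value x) ∎
  where n = length x

reflectedIndex : ∀ {v c p} → suc (v + c) ≡ p → 2 * (2 * p) ∸ (p + v) ∸ 1 ≡ 2 * p + c
reflectedIndex {v} {c} refl =
  trans (cong (λ t → t ∸ (p + v) ∸ 1) (split v c)) (cong (_∸ 1) (m+n∸m≡n (p + v) _))
  where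
  p = suc (v + c)
  split : ∀ v c → 2 * (2 * suc (v + c)) ≡ (suc (v + c) + v) + suc (2 * suc (v + c) + c)
  split = solve 2 (λ v c → con 2 :* (con 2 :* (con 1 :+ (v :+ c)))
                         := ((con 1 :+ (v :+ c)) :+ v) :+ (con 1 :+ (con 2 :* (con 1 :+ (v :+ c)) :+ c))) refl

S-upperHalf : ∀ x → let r = value (true ∷ x) in
              S (2 ^ suc (length x) + r) ≡ S (2 ^ (suc (length x) + 1) ∸ r ∸ 1)
S-upperHalf x = begin
  S (2 ^ suc n + value (true ∷ x))
    ≡⟨ cong S (sym (value-true∷ (true ∷ x))) ⟩
  S (value (true ∷ true ∷ x))
    ≡⟨ sym (S-value (true ∷ true ∷ x) _ ≤-refl) ⟩
  #L2Subwords≤ (suc (suc n)) (true ∷ true ∷ x)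
    ≡⟨ #L2Subwords≤-true∷ (suc n) (true ∷ x) ⟩
  suc (#Subwords≤ (suc n) (true ∷ x))
    ≡⟨ cong suc (sym (#Subwords≤-complement (suc n) (true ∷ x))) ⟩
  suc (#Subwords≤ (suc n) (false ∷ map not x))
    ≡⟨ sym (#L2Subwords≤-true∷ (suc n) (false ∷ map not x)) ⟩
  #L2Subwords≤ (suc (suc n)) (true ∷ false ∷ map not x)
    ≡⟨ S-value (true ∷ false ∷ map not x) _ (≤-reflexive (cong (2 +_) (length-map not x))) ⟩
  S (value (true ∷ false ∷ map not x))
    ≡⟨ cong S (trans (value-true∷ (false ∷ map not x))
                     (cong (λ k → 2 ^ suc k + value (map not x)) (length-map not x))) ⟩
  S (2 * 2 ^ n + value (map not x))
    ≡⟨ cong S (sym (reflectedIndex (value-complement x))) ⟩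
  S (2 * (2 * 2 ^ n) ∸ (2 ^ n + value x) ∸ 1)
    ≡⟨ cong₂ (λ k r → S (2 ^ k ∸ r ∸ 1)) (+-comm 1 (suc n)) (sym (value-true∷ x)) ⟩
  S (2 ^ (suc n + 1) ∸ value (true ∷ x) ∸ 1) ∎
  where n = length x

proposition3p1 : (S 0 ≡ 1) × (S 1 ≡ 2) ×
  ((ℓ r : ℕ) → 1 ≤ ℓ → r < 2 ^ ℓ →
    (r < 2 ^ (ℓ ∸ 1) → S (2 ^ ℓ + r) ≡ S (2 ^ (ℓ ∸ 1) + r) + S r) ×
    (2 ^ (ℓ ∸ 1) ≤ r → S (2 ^ ℓ + r) ≡ S (2 ^ (ℓ + 1) ∸ r ∸ 1)))
proposition3p1 = refl , refl , recurrence
  where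
  recurrence : (ℓ r : ℕ) → 1 ≤ ℓ → r < 2 ^ ℓ →
    (r < 2 ^ (ℓ ∸ 1) → S (2 ^ ℓ + r) ≡ S (2 ^ (ℓ ∸ 1) + r) + S r) ×
    (2 ^ (ℓ ∸ 1) ≤ r → S (2 ^ ℓ + r) ≡ S (2 ^ (ℓ + 1) ∸ r ∸ 1))
  recurrence (suc m) r _ r< = lowerHalf , upperHalf
    where
    lowerHalf : r < 2 ^ m → S (2 ^ suc m + r) ≡ S (2 ^ m + r) + S r
    lowerHalf r<′ with bits m r r<′
    ... | x , refl , refl = S-lowerHalf x
    upperHalf : 2 ^ m ≤ r → S (2 ^ suc m + r) ≡ S (2 ^ (suc m + 1) ∸ r ∸ 1)
    upperHalf r≥ with bits m (r ∸ 2 ^ m) (m<2n⇒m∸n<n r≥ r<)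
    ... | x , refl , v≡ =
      subst (λ t → S (2 ^ suc m + t) ≡ S (2 ^ (suc m + 1) ∸ t ∸ 1)) r≡ (S-upperHalf x)
      where
      r≡ : value (true ∷ x) ≡ r
      r≡ = trans (value-true∷ x) (trans (cong (2 ^ m +_) v≡) (m+[n∸m]≡n r≥))
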